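{- Let $\mathbb{K}$ be a field, $k\ge1$, $d\ge1$, and let $H=([n],E)$ be a $k$-uniform hypergraph. Let $U=\{\{i_1,\dots,i_{k-1}\}\subseteq[n-1]: \{i_1,\dots,i_{k-1},n\}\in E\}$, $u=|U|$, fix an ordering of $U$, and let $A=(y_{i_1j}y_{i_2j}\cdots y_{i_{k-1}j})_{\{i_1,\dots,i_{k-1}\}\in U,\, j\in[d]}$ be the $u\times d$ matrix over $S=\mathbb{K}[y_{ij}:i\in[n],j\in[d]]$ with rows indexed by $U$ in this order. Then for every $t$ with $2\le t\le \min(u,d)$, the $t$-minor $f_t$ of $A$ formed by the first $t$ rows and the first $t$ columns is nonzero in $S/L_H^{\mathbb{K}}(d)$.
   Context: A hypergraph $H=([n],E)$ is $k$-uniform if every edge has exactly $k$ vertices. $L_H^{\mathbb{K}}(d)\subseteq S$ is the ideal generated by $f_e^{(d)}=\sum_{j=1}^d\prod_{i\in e}y_{ij}$ for $e\in E$. -}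

module Defs where

open import Level using (_⊔_)
open import Algebra.Bundles using (CommutativeRing)
open import Data.Nat as ℕ using (ℕ; zero; suc)
open import Data.Nat.Properties as ℕP using ()
open import Data.Fin as Fin using (Fin; zero; suc; punchIn)
open import Data.Fin.Subset using (Subset; inside)
open import Data.Vec as Vec using (Vec; lookup; tabulate)
open import Data.Vec.Properties as VecP using ()
open import Data.List as List using (List; []; _∷_; length)
open import Data.Product using (_×_; _,_; ∃)
open import Relation.Nullary using (¬_; yes; no; Dec)
open import Data.Bool using (Bool; true; false)
open import Relation.Binary.PropositionalEquality using (_≡_)
open import Relation.Binary.Definitions using (DecidableEquality)

IsField : ∀ {c ℓ} → CommutativeRing c ℓ → Set (c ⊔ ℓ)
IsField K = (¬ (1# ≈ 0#)) × (∀ x → ¬ (x ≈ 0#) → ∃ λ y → (x * y) ≈ 1#)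
  where open CommutativeRing K

module PolyRing {c ℓ} (K : CommutativeRing c ℓ) (n d : ℕ) where
  open CommutativeRing K using (Carrier; _≈_; _+_; _*_; -_; 0#; 1#)

  -- A monomial: exponent of y_ij is the (i , j) entry.
  Mono : Set
  Mono = Vec (Vec ℕ d) n

  _≟ₘ_ : DecidableEquality Mono
  _≟ₘ_ = VecP.≡-dec (VecP.≡-dec ℕP._≟_)

  monoMul : Mono → Mono → Mono
  monoMul a b = Vec.zipWith (Vec.zipWith ℕ._+_) a b

  monoOne : Mono
  monoOne = Vec.replicate n (Vec.replicate d 0)

  Poly : Set c
  Poly = List (Carrier × Mono)

  coeff : Poly → Mono → Carrier
  coeff [] m = 0#
  coeff ((a , m′) ∷ p) m with m′ ≟ₘ m
  ... | yes _ = a + coeff p m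
  ... | no  _ = coeff p m

  _≈ₚ_ : Poly → Poly → Set ℓ
  p ≈ₚ q = ∀ m → coeff p m ≈ coeff q m

  0ₚ : Poly
  0ₚ = []

  1ₚ : Poly
  1ₚ = (1# , monoOne) ∷ []

  _+ₚ_ : Poly → Poly → Poly
  p +ₚ q = p List.++ q

  -ₚ_ : Poly → Poly
  -ₚ p = List.map (λ { (a , m) → (- a , m) }) p

  _*ₚ_ : Poly → Poly → Poly
  p *ₚ q = List.concatMap (λ { (a , m) → List.map (λ { (b , m′) → (a * b , monoMul m m′) }) q }) p

  Σₚ : (t : ℕ) → (Fin t → Poly) → Poly
  Σₚ zero f = 0ₚ
  Σₚ (suc t) f = f zero +ₚ Σₚ t (λ i → f (suc i))

  signed : ℕ → Poly → Poly
  signed zero p = p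
  signed (suc j) p = -ₚ (signed j p)

  det : (t : ℕ) → (Fin t → Fin t → Poly) → Poly
  det zero A = 1ₚ
  det (suc t) A =
    Σₚ (suc t) (λ j → signed (Fin.toℕ j)
      (A zero j *ₚ det t (λ r c′ → A (suc r) (punchIn j c′))))

  -- The monomial ∏_{i ∈ s} y_ij (as a polynomial) for a vertex set s and column j.
  prodCol : Subset n → Fin d → Poly
  prodCol s j =
    (1# , tabulate (λ i → tabulate (λ j′ →
       ind (lookup s i) (Fin._≟_ j′ j)))) ∷ []
    where
    ind : ∀ {j′ : Fin d} → Bool → Dec (j′ ≡ j) → ℕ
    ind true (yes _) = 1
    ind _ _ = 0

  fEdge : Subset n → Poly
  fEdge e = Σₚ d (prodCol e)

  InL : List (Subset n) → Poly → Set (c ⊔ ℓ)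
  InL E f = ∃ λ (g : Fin (length E) → Poly) →
    f ≈ₚ Σₚ (length E) (λ i → g i *ₚ fEdge (List.lookup E i))

-- Let S_r be the r-th row set of the minor and C the column map, and let M be the
-- diagonal monomial ∏_r ∏_{i ∈ S_r} y_{i,C r}. Expanding the determinant, only the
-- diagonal term produces M (an off-diagonal term has column C(j) equal to the row
-- S_0 ≠ S_j), so M has coefficient 1 in the minor. On the other hand every monomial
-- of f_e, namely ∏_{i ∈ e} y_ij, contains a variable absent from M: if j = C r then
-- |e| = k > |S_r| gives i ∈ e with i ∉ S_r, and otherwise column j of M is empty.
-- Multiplying keeps that variable, so M has coefficient 0 in every element of the
-- ideal, whence 1 = 0 if the minor lay in it.
module Submission where

open import Defs
open import Algebra.Bundles using (CommutativeRing)
open import Data.Nat using (ℕ; suc; _≤_)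
open import Data.Fin using (Fin; fromℕ; inject≤)
open import Data.Fin.Subset using (Subset; _∉_; _∪_; ⁅_⁆; ∣_∣)
open import Data.List using (List; length; lookup)
open import Data.List.Relation.Unary.All using (All)
open import Data.List.Relation.Unary.Unique.Propositional using (Unique)
open import Data.List.Membership.Propositional using () renaming (_∈_ to _∈ₗ_)
open import Data.Product using (_×_)
open import Function.Bundles using (_⇔_)
open import Relation.Nullary using (¬_)
open import Relation.Binary.PropositionalEquality using (_≡_)

open import Data.Nat as ℕ using (zero; _<_)
import Data.Nat.Properties as ℕP
open import Data.Fin as Fin using (zero; suc; punchIn)
import Data.Fin.Properties as FinP
open import Data.Fin.Subset using (⊥; _∈_; _⊆_; inside; outside)
import Data.Fin.Subset.Properties as SubP
open SubP using (_∈?_)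
open import Data.Vec as Vec using (tabulate)
import Data.Vec.Properties as VecP
open import Data.List using ([]; _∷_)
import Data.List.Relation.Unary.All as All
import Data.List.Relation.Unary.All.Properties as AllP
open import Data.List.Relation.Unary.AllPairs using (_∷_)
open import Data.List.Membership.Propositional.Properties using (∈-lookup)
open import Data.Bool using (true; false; if_then_else_)
open import Data.Product using (_,_; proj₂; ∃; ∃₂)
open import Data.Sum using (inj₂)
open import Data.Unit using (⊤; tt)
open import Function.Base using (_∘_; _∋_)
open import Function.Bundles using (Equivalence)
open import Function.Definitions using (Injective)
open import Relation.Nullary using (yes; no; _×-dec_; ¬?)
open import Relation.Nullary.Negation using (contradiction)
open import Relation.Binary.PropositionalEquality as ≡ using (refl; cong; cong₂; _≢_)

Unique⇒lookup-injective : ∀ {a} {A : Set a} {xs : List A} → Unique xs →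
  Injective _≡_ _≡_ (lookup xs)
Unique⇒lookup-injective (_ ∷ _)     {zero}  {zero}  _  = refl
Unique⇒lookup-injective (x∉xs ∷ _)  {zero}  {suc j} eq = contradiction eq (All.lookup x∉xs (∈-lookup j))
Unique⇒lookup-injective (x∉xs ∷ _)  {suc i} {zero}  eq =
  contradiction (≡.sym eq) (All.lookup x∉xs (∈-lookup i))
Unique⇒lookup-injective (_ ∷ xs-unique) {suc i} {suc j} eq =
  cong suc (Unique⇒lookup-injective xs-unique eq)

∉⇒lookup≡outside : ∀ {n} {p : Subset n} {x} → x ∉ p → Vec.lookup p x ≡ outside
∉⇒lookup≡outside {p = p} {x} x∉p with Vec.lookup p x in eq
... | inside  = contradiction (VecP.lookup⇒[]= x p eq) x∉p
... | outside = refl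

∣q∣<∣p∣⇒∃∈p∉q : ∀ {n} {p q : Subset n} → ∣ q ∣ < ∣ p ∣ → ∃ λ x → x ∈ p × x ∉ q
∣q∣<∣p∣⇒∃∈p∉q {p = p} {q} ∣q∣<∣p∣ with FinP.any? (λ x → (x ∈? p) ×-dec ¬? (x ∈? q))
... | yes found = found
... | no none = contradiction (SubP.p⊆q⇒∣p∣≤∣q∣ p⊆q) (ℕP.<⇒≱ ∣q∣<∣p∣)
  where
  p⊆q : p ⊆ q
  p⊆q {x} x∈p with x ∈? q
  ... | yes x∈q = x∈q
  ... | no x∉q = contradiction (x , x∈p , x∉q) none

x∉p⇒∣p∣<∣p∪⁅x⁆∣ : ∀ {n} {p : Subset n} {x} → x ∉ p → ∣ p ∣ < ∣ p ∪ ⁅ x ⁆ ∣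
x∉p⇒∣p∣<∣p∪⁅x⁆∣ {p = p} {x} x∉p = SubP.p⊂q⇒∣p∣<∣q∣
  (SubP.p⊆p∪q ⁅ x ⁆ , x , SubP.x∈p∪q⁺ (inj₂ (SubP.x∈⁅x⁆ x)) , x∉p)

module Monomials {c ℓ} (K : CommutativeRing c ℓ) (n d : ℕ) where
  open CommutativeRing K hiding (zero) renaming (refl to ≈-refl; sym to ≈-sym; trans to ≈-trans)
  open PolyRing K n d
  open import Relation.Binary.Reasoning.Setoid setoid

  exponent : Mono → Fin n → Fin d → ℕ
  exponent m x j = Vec.lookup (Vec.lookup m x) j

  exponent-monoMul : ∀ a b x j → exponent (monoMul a b) x j ≡ exponent a x j ℕ.+ exponent b x j
  exponent-monoMul a b x j = ≡.trans
    (cong (λ v → Vec.lookup v j) (VecP.lookup-zipWith (Vec.zipWith ℕ._+_) x a b))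
    (VecP.lookup-zipWith ℕ._+_ j (Vec.lookup a x) (Vec.lookup b x))

  exponent-monoOne : ∀ x j → exponent monoOne x j ≡ 0
  exponent-monoOne x j = ≡.trans
    (cong (λ v → Vec.lookup v j) (VecP.lookup-replicate x (Vec.replicate d 0)))
    (VecP.lookup-replicate j 0)

  exponent-tabulate : ∀ (f : Fin n → Fin d → ℕ) x j →
    exponent (tabulate λ x → tabulate (f x)) x j ≡ f x j
  exponent-tabulate f x j = ≡.trans
    (cong (λ v → Vec.lookup v j) (VecP.lookup∘tabulate (λ x → tabulate (f x)) x))
    (VecP.lookup∘tabulate (f x) j)

  exponent-ext : ∀ a b → (∀ x j → exponent a x j ≡ exponent b x j) → a ≡ b
  exponent-ext a b a≗b = ≡.trans (≡.sym (VecP.tabulate∘lookup a))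
    (≡.trans (VecP.tabulate-cong row≡) (VecP.tabulate∘lookup b))
    where
    row≡ : ∀ x → Vec.lookup a x ≡ Vec.lookup b x
    row≡ x = ≡.trans (≡.sym (VecP.tabulate∘lookup _))
      (≡.trans (VecP.tabulate-cong (a≗b x)) (VecP.tabulate∘lookup _))

  monoMul-cancelˡ : ∀ μ a b → monoMul μ a ≡ monoMul μ b → a ≡ b
  monoMul-cancelˡ μ a b eq = exponent-ext a b λ x j → ℕP.+-cancelˡ-≡ (exponent μ x j) _ _
    (≡.trans (≡.sym (exponent-monoMul μ a x j))
      (≡.trans (cong (λ m → exponent m x j) eq) (exponent-monoMul μ b x j)))

  ∏ₘ : (t : ℕ) → (Fin t → Mono) → Mono
  ∏ₘ zero    f = monoOne
  ∏ₘ (suc t) f = monoMul (f zero) (∏ₘ t (f ∘ suc))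

  exponent-∏ₘ-zero : ∀ t (f : Fin t → Mono) x j → (∀ r → exponent (f r) x j ≡ 0) →
    exponent (∏ₘ t f) x j ≡ 0
  exponent-∏ₘ-zero zero    f x j _  = exponent-monoOne x j
  exponent-∏ₘ-zero (suc t) f x j f0 = ≡.trans (exponent-monoMul (f zero) _ x j)
    (cong₂ ℕ._+_ (f0 zero) (exponent-∏ₘ-zero t (f ∘ suc) x j (f0 ∘ suc)))

  exponent-∏ₘ-single : ∀ t (f : Fin t → Mono) x j r →
    (∀ r′ → r′ ≢ r → exponent (f r′) x j ≡ 0) → exponent (∏ₘ t f) x j ≡ exponent (f r) x j
  exponent-∏ₘ-single (suc t) f x j zero f0 = ≡.trans (exponent-monoMul (f zero) _ x j)
    (≡.trans (cong (exponent (f zero) x j ℕ.+_)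
               (exponent-∏ₘ-zero t (f ∘ suc) x j (λ r → f0 (suc r) (λ ()))))
             (ℕP.+-identityʳ _))
  exponent-∏ₘ-single (suc t) f x j (suc r) f0 = ≡.trans (exponent-monoMul (f zero) _ x j)
    (cong₂ ℕ._+_ (f0 zero (λ ()))
               (exponent-∏ₘ-single t (f ∘ suc) x j r
                  (λ r′ r′≢r → f0 (suc r′) (r′≢r ∘ FinP.suc-injective))))

  -- prodCol s j ≡ (1# , colMono s j) ∷ [] by computation; the [] clause is unreachable.
  colMono : Subset n → Fin d → Mono
  colMono s j with prodCol s j
  ... | (_ , m) ∷ _ = m
  ... | []          = monoOne

  -- The exponents of prodCol are computed by a helper local to its definition, which
  -- cannot be named here; ascribing the type of exponent-tabulate exposes it applied to
  -- lookup s x and j′ ≟ j, which the with-clause then abstracts.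
  exponent-colMono-col : ∀ s j x → exponent (colMono s j) x j ≡ (if Vec.lookup s x then 1 else 0)
  exponent-colMono-col s j x
    with Vec.lookup s x | j Fin.≟ j | (exponent (colMono s j) x j ≡ _) ∋ exponent-tabulate _ x j
  ... | true  | yes _   | e = e
  ... | true  | no j≢j  | _ = contradiction refl j≢j
  ... | false | _       | e = e

  exponent-colMono-≢ : ∀ s {j j′} x → j′ ≢ j → exponent (colMono s j) x j′ ≡ 0
  exponent-colMono-≢ s {j} {j′} x j′≢j
    with Vec.lookup s x | j′ Fin.≟ j | (exponent (colMono s j) x j′ ≡ _) ∋ exponent-tabulate _ x j′
  ... | true  | yes j′≡j | _ = contradiction j′≡j j′≢j
  ... | true  | no _     | e = e
  ... | false | _        | e = e

  colMono-column-injective : ∀ s s′ j →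
    (∀ x → exponent (colMono s j) x j ≡ exponent (colMono s′ j) x j) → s ≡ s′
  colMono-column-injective s s′ j same = ≡.trans (≡.sym (VecP.tabulate∘lookup s))
    (≡.trans (VecP.tabulate-cong lookup≡) (VecP.tabulate∘lookup s′))
    where
    indicator-injective : ∀ a b → (if a then 1 else 0) ≡ (if b then 1 else 0) → a ≡ b
    indicator-injective true  true  _ = refl
    indicator-injective false false _ = refl
    indicator-injective true  false ()
    indicator-injective false true  ()

    lookup≡ : ∀ x → Vec.lookup s x ≡ Vec.lookup s′ x
    lookup≡ x = indicator-injective _ _ (≡.trans (≡.sym (exponent-colMono-col s j x))
      (≡.trans (same x) (exponent-colMono-col s′ j x)))

  exponent-colMono-∈ : ∀ s j {x} → x ∈ s → exponent (colMono s j) x j ≡ 1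
  exponent-colMono-∈ s j {x} x∈s =
    ≡.trans (exponent-colMono-col s j x) (cong (λ b → if b then 1 else 0) (VecP.[]=⇒lookup x∈s))

  exponent-colMono-∈-≢0 : ∀ s j {x} → x ∈ s → exponent (colMono s j) x j ≢ 0
  exponent-colMono-∈-≢0 s j x∈s = ℕP.1+n≢0 ∘ ≡.trans (≡.sym (exponent-colMono-∈ s j x∈s))

  exponent-colMono-∉ : ∀ s j {x} → x ∉ s → exponent (colMono s j) x j ≡ 0
  exponent-colMono-∉ s j {x} x∉s =
    ≡.trans (exponent-colMono-col s j x) (cong (λ b → if b then 1 else 0) (∉⇒lookup≡outside x∉s))

  diagMono : (t : ℕ) → (Fin t → Subset n) → (Fin t → Fin d) → Mono
  diagMono t S C = ∏ₘ t λ r → colMono (S r) (C r)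

  exponent-diagMono-col : ∀ t S C → Injective _≡_ _≡_ C → ∀ x r →
    exponent (diagMono t S C) x (C r) ≡ exponent (colMono (S r) (C r)) x (C r)
  exponent-diagMono-col t S C C-inj x r = exponent-∏ₘ-single t _ x (C r) r
    λ r′ r′≢r → exponent-colMono-≢ (S r′) x (r′≢r ∘ C-inj ∘ ≡.sym)

  exponent-diagMono-∉ : ∀ t S C x j → (∀ r → C r ≢ j) → exponent (diagMono t S C) x j ≡ 0
  exponent-diagMono-∉ t S C x j j∉C = exponent-∏ₘ-zero t _ x j
    λ r → exponent-colMono-≢ (S r) x (j∉C r ∘ ≡.sym)

  AllMonomials : (Mono → Set) → Poly → Set c
  AllMonomials Q = All (Q ∘ proj₂)

  module _ {Q : Mono → Set} where

    allMonomials-+ₚ : ∀ {p q} → AllMonomials Q p → AllMonomials Q q → AllMonomials Q (p +ₚ q)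
    allMonomials-+ₚ = AllP.++⁺

    allMonomials-signed : ∀ j {p} → AllMonomials Q p → AllMonomials Q (signed j p)
    allMonomials-signed zero    Qp = Qp
    allMonomials-signed (suc j) Qp = AllP.map⁺ (allMonomials-signed j Qp)

    allMonomials-Σₚ : ∀ t {f : Fin t → Poly} → (∀ r → AllMonomials Q (f r)) →
      AllMonomials Q (Σₚ t f)
    allMonomials-Σₚ zero    Qf = All.[]
    allMonomials-Σₚ (suc t) Qf = allMonomials-+ₚ (Qf zero) (allMonomials-Σₚ t (Qf ∘ suc))

  allMonomials-*ₚ : ∀ {Q₁ Q₂ R : Mono → Set} → (∀ {a b} → Q₁ a → Q₂ b → R (monoMul a b)) →
    ∀ {p q} → AllMonomials Q₁ p → AllMonomials Q₂ q → AllMonomials R (p *ₚ q)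
  allMonomials-*ₚ combine Q₁p Q₂q =
    AllP.concat⁺ (AllP.map⁺ (All.map (λ Q₁a → AllP.map⁺ (All.map (combine Q₁a) Q₂q)) Q₁p))

  allMonomials-det : ∀ {Q : Mono → Set} → Q monoOne → (∀ {a b} → Q a → Q b → Q (monoMul a b)) →
    ∀ t {A : Fin t → Fin t → Poly} → (∀ r j → AllMonomials Q (A r j)) → AllMonomials Q (det t A)
  allMonomials-det Q1 Q* zero    QA = Q1 All.∷ All.[]
  allMonomials-det Q1 Q* (suc t) QA = allMonomials-Σₚ (suc t) λ j → allMonomials-signed (Fin.toℕ j)
    (allMonomials-*ₚ Q* (QA zero j) (allMonomials-det Q1 Q* t λ r c′ → QA (suc r) (punchIn j c′)))

  coeff-+ₚ : ∀ p q m → coeff (p +ₚ q) m ≈ coeff p m + coeff q m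
  coeff-+ₚ []             q m = ≈-sym (+-identityˡ _)
  coeff-+ₚ ((a , m′) ∷ p) q m with m′ ≟ₘ m
  ... | yes _ = ≈-trans (+-congˡ (coeff-+ₚ p q m)) (≈-sym (+-assoc _ _ _))
  ... | no  _ = coeff-+ₚ p q m

  coeff-absent : ∀ p m → AllMonomials (_≢ m) p → coeff p m ≈ 0#
  coeff-absent []             m All.[] = ≈-refl
  coeff-absent ((a , m′) ∷ p) m (m′≢m All.∷ rest) with m′ ≟ₘ m
  ... | yes m′≡m = contradiction m′≡m m′≢m
  ... | no  _    = coeff-absent p m rest

  coeff-monomial-*ₚ : ∀ a μ q m → coeff (((a , μ) ∷ []) *ₚ q) (monoMul μ m) ≈ a * coeff q m
  coeff-monomial-*ₚ a μ []             m = ≈-sym (zeroʳ a)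
  coeff-monomial-*ₚ a μ ((b , m′) ∷ q) m with monoMul μ m′ ≟ₘ monoMul μ m | m′ ≟ₘ m
  ... | yes _       | yes _    =
    ≈-trans (+-congˡ (coeff-monomial-*ₚ a μ q m)) (≈-sym (distribˡ a b _))
  ... | yes μm′≡μm  | no m′≢m  = contradiction (monoMul-cancelˡ μ m′ m μm′≡μm) m′≢m
  ... | no  μm′≢μm  | yes m′≡m = contradiction (cong (monoMul μ) m′≡m) μm′≢μm
  ... | no  _       | no _     = coeff-monomial-*ₚ a μ q m

  laplaceTerm : ∀ t → (Fin (suc t) → Fin (suc t) → Poly) → Fin (suc t) → Poly
  laplaceTerm t A j = A zero j *ₚ det t (λ r c′ → A (suc r) (punchIn j c′))

  -- In column C (suc j) the monomials of this term agree with colMono (S zero), as the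
  -- complementary minor avoids that column, whereas diagMono agrees with colMono (S (suc j)).
  offDiagonal-term-≢ : ∀ t (S : Fin (suc t) → Subset n) C →
    Injective _≡_ _≡_ C → Injective _≡_ _≡_ S → ∀ j →
    AllMonomials (_≢ diagMono (suc t) S C) (laplaceTerm t (λ r j → prodCol (S r) (C j)) (suc j))
  offDiagonal-term-≢ t S C C-inj S-inj j = All.map row≢
    (allMonomials-*ₚ {Q₁ = ColumnOf (S zero)} {Q₂ = ColumnZero}
      (λ {a} {b} col-a col-b x → ≡.trans (exponent-monoMul a b x col)
         (≡.trans (cong₂ ℕ._+_ (col-a x) (col-b x)) (ℕP.+-identityʳ _)))
      ((λ _ → refl) All.∷ All.[])
      (allMonomials-det {Q = ColumnZero} (λ x → exponent-monoOne x col)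
         (λ {a} {b} zero-a zero-b x →
            ≡.trans (exponent-monoMul a b x col) (cong₂ ℕ._+_ (zero-a x) (zero-b x)))
         t λ r c′ → (λ x → exponent-colMono-≢ (S (suc r)) x
                       (FinP.punchInᵢ≢i (suc j) c′ ∘ C-inj ∘ ≡.sym)) All.∷ All.[]))
    where
    col : Fin d
    col = C (suc j)

    ColumnOf : Subset n → Mono → Set
    ColumnOf s m = ∀ x → exponent m x col ≡ exponent (colMono s col) x col

    ColumnZero : Mono → Set
    ColumnZero m = ∀ x → exponent m x col ≡ 0

    row≢ : ∀ {m} → ColumnOf (S zero) m → m ≢ diagMono (suc t) S C
    row≢ {m} col-m m≡diag = contradiction (S-inj (colMono-column-injective (S zero) (S (suc j)) col
      λ x → ≡.trans (≡.sym (col-m x)) (≡.trans (cong (λ m → exponent m x col) m≡diag)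
              (exponent-diagMono-col (suc t) S C C-inj x (suc j)))))
      λ ()

  coeff-det-diagMono : ∀ t (S : Fin t → Subset n) C → Injective _≡_ _≡_ C → Injective _≡_ _≡_ S →
    coeff (det t λ r j → prodCol (S r) (C j)) (diagMono t S C) ≈ 1#
  coeff-det-diagMono zero    S C C-inj S-inj with monoOne ≟ₘ monoOne
  ... | yes _       = +-identityʳ 1#
  ... | no  one≢one = contradiction refl one≢one
  coeff-det-diagMono (suc t) S C C-inj S-inj = begin
    coeff (diagonalTerm +ₚ offDiagonalTerms) M              ≈⟨ coeff-+ₚ diagonalTerm _ M ⟩
    coeff diagonalTerm M + coeff offDiagonalTerms M         ≈⟨ +-cong diagonal offDiagonal ⟩
    1# * 1# + 0#                                            ≈⟨ +-identityʳ _ ⟩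
    1# * 1#                                                 ≈⟨ *-identityˡ 1# ⟩
    1#                                                      ∎
    where
    M : Mono
    M = diagMono (suc t) S C
    minorDet diagonalTerm offDiagonalTerms : Poly
    minorDet = det t (λ r j → prodCol (S (suc r)) (C (suc j)))
    diagonalTerm = prodCol (S zero) (C zero) *ₚ minorDet
    offDiagonalTerms = Σₚ t λ j →
      signed (Fin.toℕ (suc j)) (laplaceTerm t (λ r j → prodCol (S r) (C j)) (suc j))

    diagonal : coeff diagonalTerm M ≈ 1# * 1#
    diagonal = ≈-trans
      (coeff-monomial-*ₚ 1# (colMono (S zero) (C zero)) minorDet (diagMono t (S ∘ suc) (C ∘ suc)))
      (*-congˡ (coeff-det-diagMono t (S ∘ suc) (C ∘ suc)
                  (FinP.suc-injective ∘ C-inj) (FinP.suc-injective ∘ S-inj)))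

    offDiagonal : coeff offDiagonalTerms M ≈ 0#
    offDiagonal = coeff-absent offDiagonalTerms M (allMonomials-Σₚ t λ j →
      allMonomials-signed (Fin.toℕ (suc j)) (offDiagonal-term-≢ t S C C-inj S-inj j))

  UsesVariableOutside : Mono → Mono → Set
  UsesVariableOutside M m = ∃₂ λ x j → exponent m x j ≢ 0 × exponent M x j ≡ 0

  usesVariableOutside-monoMulˡ : ∀ {M} a {b} → UsesVariableOutside M b →
    UsesVariableOutside M (monoMul a b)
  usesVariableOutside-monoMulˡ a {b} (x , j , b≢0 , M≡0) =
    x , j , (λ ab≡0 → b≢0 (ℕP.m+n≡0⇒n≡0 (exponent a x j)
                            (≡.trans (≡.sym (exponent-monoMul a b x j)) ab≡0))) , M≡0

  usesVariableOutside⇒≢ : ∀ {M m} → UsesVariableOutside M m → m ≢ M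
  usesVariableOutside⇒≢ (x , j , m≢0 , M≡0) m≡M =
    m≢0 (≡.trans (cong (λ m → exponent m x j) m≡M) M≡0)

  coeff-ideal-vanishes : ∀ E f M → All (λ e → ∀ j → UsesVariableOutside M (colMono e j)) E →
    InL E f → coeff f M ≈ 0#
  coeff-ideal-vanishes E f M edges-outside (g , f≈) = ≈-trans (f≈ M) (coeff-absent _ M
    (All.map (usesVariableOutside⇒≢ {M}) (allMonomials-Σₚ (length E) λ i →
      allMonomials-*ₚ {Q₁ = λ _ → ⊤} {Q₂ = UsesVariableOutside M}
        (λ {a} _ → usesVariableOutside-monoMulˡ {M} a)
        (All.universal (λ _ → tt) (g i))
        (allMonomials-Σₚ d λ j → All.lookup edges-outside (∈-lookup i) j All.∷ All.[]))))

  colMono-usesVariableOutside-diagMono : ∀ t S C → Injective _≡_ _≡_ C →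
    ∀ k → 0 < k → (∀ r → ∣ S r ∣ < k) → ∀ {e} → ∣ e ∣ ≡ k → ∀ j →
    UsesVariableOutside (diagMono t S C) (colMono e j)
  colMono-usesVariableOutside-diagMono t S C C-inj k 0<k rows-small {e} refl j
    with FinP.any? (λ r → C r Fin.≟ j)
  ... | yes (r , refl) with ∣q∣<∣p∣⇒∃∈p∉q {p = e} (rows-small r)
  ...   | x , x∈e , x∉S =
    x , C r , exponent-colMono-∈-≢0 e (C r) x∈e ,
    ≡.trans (exponent-diagMono-col t S C C-inj x r) (exponent-colMono-∉ (S r) (C r) x∉S)
  colMono-usesVariableOutside-diagMono t S C C-inj k 0<k rows-small {e} refl j
      | no j∉C with ∣q∣<∣p∣⇒∃∈p∉q {p = e} {q = ⊥} (≡.subst (_< ∣ e ∣) (≡.sym (SubP.∣⊥∣≡0 n)) 0<k)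
  ...   | x , x∈e , _ =
    x , j , exponent-colMono-∈-≢0 e j x∈e , exponent-diagMono-∉ t S C x j λ r Cr≡j → j∉C (r , Cr≡j)

lemma2p3 : ∀ {c ℓ} (K : CommutativeRing c ℓ) → IsField K →
    (k d m : ℕ) → 1 ≤ k → 1 ≤ d →
    (E : List (Subset (suc m))) → All (λ e → ∣ e ∣ ≡ k) E →
    (Us : List (Subset (suc m))) → Unique Us →
    (∀ s → (s ∈ₗ Us) ⇔ ((fromℕ m ∉ s) × ((s ∪ ⁅ fromℕ m ⁆) ∈ₗ E))) →
    (t : ℕ) → 2 ≤ t → (t≤u : t ≤ length Us) → (t≤d : t ≤ d) →
    let open PolyRing K (suc m) d in
    ¬ InL E (det t (λ r j → prodCol (lookup Us (inject≤ r t≤u)) (inject≤ j t≤d)))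
lemma2p3 K (1≉0 , _) k d m 0<k _ E ∣E∣≡k Us Us-unique Us-spec t _ t≤u t≤d minor∈L =
  1≉0 (≈-trans (≈-sym (coeff-det-diagMono t S C C-inj S-inj))
               (coeff-ideal-vanishes E (det t λ r j → prodCol (S r) (C j)) (diagMono t S C)
                  edges-outside minor∈L))
  where
  open CommutativeRing K using () renaming (sym to ≈-sym; trans to ≈-trans)
  open PolyRing K (suc m) d
  open Monomials K (suc m) d

  S : Fin t → Subset (suc m)
  S r = lookup Us (inject≤ r t≤u)

  C : Fin t → Fin d
  C j = inject≤ j t≤d

  C-inj : Injective _≡_ _≡_ C
  C-inj = FinP.inject≤-injective t≤d t≤d _ _

  S-inj : Injective _≡_ _≡_ S
  S-inj = FinP.inject≤-injective t≤u t≤u _ _ ∘ Unique⇒lookup-injective Us-unique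

  rows-small : ∀ r → ∣ S r ∣ < k
  rows-small r with Equivalence.to (Us-spec (S r)) (∈-lookup (inject≤ r t≤u))
  ... | last∉S , S∪last∈E =
    ≡.subst (∣ S r ∣ <_) (All.lookup ∣E∣≡k S∪last∈E) (x∉p⇒∣p∣<∣p∪⁅x⁆∣ last∉S)

  edges-outside : All (λ e → ∀ j → UsesVariableOutside (diagMono t S C) (colMono e j)) E
  edges-outside = All.map
    (λ {e} → colMono-usesVariableOutside-diagMono t S C C-inj k 0<k rows-small {e}) ∣E∣≡k
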